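{- Wilf equivalence and strong Wilf equivalence classes of consecutive patterns of relations in inversion sequences do not coincide in general: there exist $R_1,R_2,R_1',R_2'\in\{\leq,\geq,<,>,=,\neq\}$ such that $(\underline{R_1,R_2})$ and $(\underline{R_1',R_2'})$ are Wilf equivalent but not strongly Wilf equivalent.
   Context: An inversion sequence of length $n$ is an integer sequence $e=e_1\dots e_n$ with $0\le e_i<i$ for all $i$; $\mathbf{I}_n$ is the set of these. For $R_1,R_2\in\{\leq,\geq,<,>,=,\neq\}$, an occurrence of the consecutive pattern of relations $(\underline{R_1,R_2})$ in $e$ is an index $i$ with $e_iR_1e_{i+1}$ and $e_{i+1}R_2e_{i+2}$; $e$ avoids the pattern if it has no occurrence, and $\mathbf{I}_n(\underline{R_1,R_2})$ is the set of avoiders. Two patterns are Wilf equivalent if they have equally many avoiders in $\mathbf{I}_n$ for every $n$, and strongly Wilf equivalent if for all $n,m$ the number of $e\in\mathbf{I}_n$ with exactly $m$ occurrences is the same for both patterns. -}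

module Defs where

open import Data.Nat using (ℕ; zero; suc; _+_; _≡ᵇ_; _≤ᵇ_; _<ᵇ_)
open import Data.Bool using (Bool; true; false; not; _∧_; if_then_else_)
open import Data.List using (List; []; _∷_; _++_; [_]; map; concatMap; upTo; length; filter)
open import Data.Product using (_×_; ∃-syntax)
open import Relation.Binary.PropositionalEquality using (_≡_)
open import Relation.Nullary using (¬_)

data Rel : Set where
  le ge lt gt eq ne : Rel

holds : Rel → ℕ → ℕ → Bool
holds le a b = a ≤ᵇ b
holds ge a b = b ≤ᵇ a
holds lt a b = a <ᵇ b
holds gt a b = b <ᵇ a
holds eq a b = a ≡ᵇ b
holds ne a b = not (a ≡ᵇ b)

-- Inversion sequences of length n: lists e₁…eₙ with 0 ≤ eᵢ < i.
InvSeqs : ℕ → List (List ℕ)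
InvSeqs zero = [] ∷ []
InvSeqs (suc n) = concatMap (λ e → map (λ x → e ++ [ x ]) (upTo (suc n))) (InvSeqs n)

occ : Rel → Rel → List ℕ → ℕ
occ R₁ R₂ (a ∷ b ∷ c ∷ rest) =
  (if holds R₁ a b ∧ holds R₂ b c then 1 else 0) + occ R₁ R₂ (b ∷ c ∷ rest)
occ R₁ R₂ _ = 0

numWithOcc : Rel → Rel → ℕ → ℕ → ℕ
numWithOcc R₁ R₂ n m = length (filter (λ e → occ R₁ R₂ e Data.Nat.≟ m) (InvSeqs n))

numAvoid : Rel → Rel → ℕ → ℕ
numAvoid R₁ R₂ n = numWithOcc R₁ R₂ n 0

WilfEquiv : Rel → Rel → Rel → Rel → Set
WilfEquiv R₁ R₂ R₁' R₂' = ∀ n → numAvoid R₁ R₂ n ≡ numAvoid R₁' R₂' n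

StronglyWilfEquiv : Rel → Rel → Rel → Rel → Set
StronglyWilfEquiv R₁ R₂ R₁' R₂' =
  ∀ n m → numWithOcc R₁ R₂ n m ≡ numWithOcc R₁' R₂' n m

module Submission where

-- Call a relation R "strict-like" if it holds on every
-- strict ascent a < b and fails on 0,0; both < and ≠ are strict-like.  For
-- such R, a sequence a b r with a < b avoids (R,≥) iff b r is strictly
-- increasing (the first weak descent after an ascent is an occurrence), and
-- a sequence 0 r avoids (R,≥) iff r is a block of zeros followed by a strictly
-- increasing run.  This description does not mention R, so on sequences
-- starting with 0 -- which all non-empty inversion sequences do -- avoiding
-- (<,≥) and avoiding (≠,≥) are equivalent, and the avoiders are counted by
-- filtering the same list with equivalent predicates.
--
-- Failure of strong Wilf equivalence is a finite computation: in I₄ there are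
-- 16 sequences with exactly one occurrence of (<,≥) but 15 for (≠,≥).

open import Defs
open import Data.Bool using (true; false; T; not)
open import Data.Empty using (⊥-elim)
open import Data.List using (List; []; _∷_; _++_; [_]; map; filter; length; upTo)
open import Data.List.Relation.Unary.All as All using (All; []; _∷_)
open import Data.List.Relation.Unary.All.Properties using (concat⁺; map⁺)
open import Data.List.Relation.Unary.Linked using (Linked; [-]; _∷_)
open import Data.Nat using (ℕ; zero; suc; _<_; _≤ᵇ_; _≡ᵇ_; z<s)
open import Data.Nat.Properties using (≤ᵇ-reflects-≤; ≰⇒>; <⇒≢; <⇒≱; ≡ᵇ⇒≡; <⇒<ᵇ)
open import Data.Product using (_×_; ∃-syntax; _,_)
open import Data.Unit using (⊤; tt)
open import Function.Bundles using (_⇔_; mk⇔; Equivalence)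
open import Relation.Binary.PropositionalEquality using (_≡_; refl; cong; sym; trans)
open import Relation.Nullary using (¬_; yes; no)
open import Relation.Nullary.Reflects using (ofʸ; ofⁿ)
open import Relation.Unary using (Decidable)

open Equivalence using (to; from)

Avoids : Rel → Rel → List ℕ → Set
Avoids R₁ R₂ e = occ R₁ R₂ e ≡ 0

record StrictLike (R : Rel) : Set where
  field
    onAscent : ∀ {a b} → a < b → T (holds R a b)
    not00    : ¬ T (holds R 0 0)
open StrictLike

lt-strictLike : StrictLike lt
lt-strictLike = record { onAscent = <⇒<ᵇ ; not00 = λ () }

ne-strictLike : StrictLike ne
ne-strictLike = record { onAscent = ascent ; not00 = λ () }
  where
  ascent : ∀ {a b} → a < b → T (not (a ≡ᵇ b))
  ascent {a} {b} a<b with a ≡ᵇ b | ≡ᵇ⇒≡ a b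
  ... | false | _     = tt
  ... | true  | sound = <⇒≢ a<b (sound tt)

StrictlyIncreasing : List ℕ → Set
StrictlyIncreasing = Linked _<_

ZerosThenIncreasing : List ℕ → Set
ZerosThenIncreasing []          = ⊤
ZerosThenIncreasing (zero  ∷ r) = ZerosThenIncreasing r
ZerosThenIncreasing (suc b ∷ r) = StrictlyIncreasing (suc b ∷ r)

-- After an ascent a < b, a strict-like R makes every weak descent b ≥ c an
-- occurrence of (R,≥); so avoiding means that b r keeps increasing.
avoid-after-ascent : ∀ {R} → StrictLike R → ∀ {a b} r → a < b →
  Avoids R ge (a ∷ b ∷ r) ⇔ StrictlyIncreasing (b ∷ r)
avoid-after-ascent s []      a<b = mk⇔ (λ _ → [-]) (λ _ → refl)
avoid-after-ascent {R} s {a} {b} (c ∷ r) a<b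
  with holds R a b | onAscent s a<b | c ≤ᵇ b | ≤ᵇ-reflects-≤ c b
... | true | _ | true  | ofʸ c≤b = mk⇔ (λ ()) (λ { (b<c ∷ _) → ⊥-elim (<⇒≱ b<c c≤b) })
... | true | _ | false | ofⁿ c≰b = mk⇔ (λ av → b<c ∷ to ih av) (λ { (_ ∷ inc) → from ih inc })
  where
  b<c : b < c
  b<c = ≰⇒> c≰b
  ih : Avoids R ge (b ∷ c ∷ r) ⇔ StrictlyIncreasing (c ∷ r)
  ih = avoid-after-ascent s r b<c

drop-leading-zero : ∀ {R} → StrictLike R → ∀ r →
  occ R ge (0 ∷ 0 ∷ r) ≡ occ R ge (0 ∷ r)
drop-leading-zero s []            = refl
drop-leading-zero {R} s (_ ∷ _) with holds R 0 0 | not00 s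
... | false | _ = refl
... | true  | n = ⊥-elim (n tt)

avoid-from-zero : ∀ {R} → StrictLike R → ∀ r →
  Avoids R ge (0 ∷ r) ⇔ ZerosThenIncreasing r
avoid-from-zero s []          = mk⇔ (λ _ → tt) (λ _ → refl)
avoid-from-zero {R} s (zero ∷ r) =
  mk⇔ (λ av → to ih (trans (sym (drop-leading-zero s r)) av))
      (λ shape → trans (drop-leading-zero s r) (from ih shape))
  where
  ih : Avoids R ge (0 ∷ r) ⇔ ZerosThenIncreasing r
  ih = avoid-from-zero s r
avoid-from-zero s (suc b ∷ r) = avoid-after-ascent s r z<s

same-avoiders-from-zero : ∀ {R R'} → StrictLike R → StrictLike R' → ∀ r →
  Avoids R ge (0 ∷ r) ⇔ Avoids R' ge (0 ∷ r)
same-avoiders-from-zero s s' r =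
  mk⇔ (λ av → from (avoid-from-zero s' r) (to (avoid-from-zero s r) av))
      (λ av → from (avoid-from-zero s r) (to (avoid-from-zero s' r) av))

StartsWithZero : List ℕ → Set
StartsWithZero e = ∃[ r ] e ≡ 0 ∷ r

invSeqs-start-with-zero : ∀ n → All StartsWithZero (InvSeqs (suc n))
invSeqs-start-with-zero zero    = (_ , refl) ∷ []
invSeqs-start-with-zero (suc n) =
  concat⁺ (map⁺ (All.map extensions (invSeqs-start-with-zero n)))
  where
  extensions : ∀ {e} → StartsWithZero e →
    All StartsWithZero (map (λ x → e ++ [ x ]) (upTo (suc (suc n))))
  extensions (r , refl) = map⁺ (All.universal (λ x → r ++ [ x ] , refl) _)

filter-cong-on : ∀ {A : Set} {P Q : A → Set} (P? : Decidable P) (Q? : Decidable Q) →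
  ∀ {xs} → All (λ x → P x ⇔ Q x) xs → filter P? xs ≡ filter Q? xs
filter-cong-on P? Q? {[]}     []             = refl
filter-cong-on P? Q? {x ∷ xs} (P⇔Q ∷ agrees) with P? x | Q? x
... | yes _ | yes _ = cong (x ∷_) (filter-cong-on P? Q? agrees)
... | no _  | no _  = filter-cong-on P? Q? agrees
... | yes p | no ¬q = ⊥-elim (¬q (to P⇔Q p))
... | no ¬p | yes q = ⊥-elim (¬p (from P⇔Q q))

strictLike-wilf : ∀ {R R'} → StrictLike R → StrictLike R' → WilfEquiv R ge R' ge
strictLike-wilf         s s' zero    = refl
strictLike-wilf {R} {R'} s s' (suc n) =
  cong length (filter-cong-on _ _ (All.map agree (invSeqs-start-with-zero n)))
  where
  agree : ∀ {e} → StartsWithZero e → Avoids R ge e ⇔ Avoids R' ge e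
  agree (r , refl) = same-avoiders-from-zero s s' r

-- In I₄, 16 sequences contain (<,≥) exactly once but only 15 contain (≠,≥)
-- exactly once: the only difference is 0100, which contains (<,≥) once but
-- (≠,≥) twice.
one-occurrence-lt-ge : numWithOcc lt ge 4 1 ≡ 16
one-occurrence-lt-ge = refl

one-occurrence-ne-ge : numWithOcc ne ge 4 1 ≡ 15
one-occurrence-ne-ge = refl

lt-ge-not-strongly-ne-ge : ¬ StronglyWilfEquiv lt ge ne ge
lt-ge-not-strongly-ne-ge strong
  with trans (sym one-occurrence-lt-ge) (trans (strong 4 1) one-occurrence-ne-ge)
... | ()

corollary2p2 : ∃[ R₁ ] ∃[ R₂ ] ∃[ R₁' ] ∃[ R₂' ]
    (WilfEquiv R₁ R₂ R₁' R₂' × ¬ StronglyWilfEquiv R₁ R₂ R₁' R₂')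
corollary2p2 =
  lt , ge , ne , ge ,
  strictLike-wilf lt-strictLike ne-strictLike ,
  lt-ge-not-strongly-ne-ge
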